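{- Let $Q=T[H_1,\dots,H_t]$ be a strong semicomplete composition and let $k\geq 4$. Then $Q$ has a $k$-kernel if and only if there is a vertex $v\in V(Q)$, with $v\in V(H_i)$ for some $i\in[t]$, such that $\{v\}$ is a $(k-1)$-absorbent set of the digraph $Q-(V(H_i)\setminus\{v\})$.
   Context: All digraphs are finite, without loops or parallel arcs; $d_D(x,y)$ is the length of a shortest directed $x$–$y$ path in $D$ (infinite if none). Let $T$ be a digraph with vertices $u_1,\dots,u_t$ ($t\ge 2$) and $H_1,\dots,H_t$ digraphs, $H_i$ having vertices $u_{i,j}$, $1\le j\le n_i$. The composition $Q=T[H_1,\dots,H_t]$ has vertex set $\{u_{i,j}\}$ and arc set $\bigcup_i A(H_i)\cup\{u_{i,j}u_{p,q}: u_iu_p\in A(T)\}$ (all $j,q$). It is a semicomplete composition if $T$ is semicomplete (at least one arc between every two distinct vertices). A digraph is strong if every vertex can reach every other vertex. In a digraph $D$, a set $K\subseteq V(D)$ is $k$-independent if $d_D(x,y)\ge k$ and $d_D(y,x)\ge k$ for all distinct $x,y\in K$; it is $\ell$-absorbent if for every $x\in V(D)\setminus K$ there is $y\in K$ with $d_D(x,y)\le \ell$. A $k$-kernel is a $k$-independent and $(k-1)$-absorbent set. $D-S$ denotes the subdigraph induced by $V(D)\setminus S$. -}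

module Defs where

open import Data.Nat using (ℕ; zero; suc; _≤_; _∸_)
open import Data.Fin using (Fin)
open import Data.Bool using (Bool; T)
open import Data.Product using (Σ; ∃; _×_; _,_; proj₁)
open import Data.Sum using (_⊎_)
open import Relation.Nullary using (¬_)
open import Relation.Binary using (Decidable)
open import Relation.Binary.PropositionalEquality using (_≡_; _≢_)

-- A finite digraph on vertex set Fin n (no loops; arcs form a relation, so no
-- parallel arcs). Adjacency is decidable, as it is for any finite digraph.
record Digraph : Set₁ where
  field
    n        : ℕ
    Arc      : Fin n → Fin n → Set
    arc?     : Decidable Arc
    loopless : ∀ x → ¬ Arc x x
open Digraph public

data Walk {V : Set} (R : V → V → Set) : ℕ → V → V → Set where
  [] : ∀ {x} → Walk R zero x x
  _∷_ : ∀ {m x y z} → R x y → Walk R m y z → Walk R (suc m) x z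

-- d(x,y) ≤ ℓ : there is a directed x–y path (equivalently walk) of length ≤ ℓ.
DistLe : {V : Set} → (V → V → Set) → ℕ → V → V → Set
DistLe R ℓ x y = Σ ℕ λ m → m ≤ ℓ × Walk R m x y

-- d(x,y) ≥ k : every directed x–y walk has length ≥ k (true if none exists).
DistGe : {V : Set} → (V → V → Set) → ℕ → V → V → Set
DistGe R k x y = ∀ m → Walk R m x y → k ≤ m

Strong : {V : Set} → (V → V → Set) → Set
Strong R = ∀ x y → Σ ℕ λ m → Walk R m x y

Independent : {V : Set} → (V → V → Set) → ℕ → (V → Set) → Set
Independent R k K = ∀ x y → K x → K y → x ≢ y → DistGe R k x y × DistGe R k y x

Absorbent : {V : Set} → (V → V → Set) → ℕ → (V → Set) → Set
Absorbent R ℓ K = ∀ x → ¬ K x → Σ _ λ y → K y × DistLe R ℓ x y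

IsKernel : {V : Set} → (V → V → Set) → ℕ → (V → Bool) → Set
IsKernel R k K = Independent R k (λ x → T (K x)) × Absorbent R (k ∸ 1) (λ x → T (K x))

HasKernel : {V : Set} → (V → V → Set) → ℕ → Set
HasKernel {V} R k = Σ (V → Bool) λ K → IsKernel R k K

-- Induced subdigraph on the vertices satisfying `keep`  (i.e. D - S with S = complement).
InducedArc : {V : Set} → (V → V → Set) → (keep : V → Set) → Σ V keep → Σ V keep → Set
InducedArc R keep x y = R (proj₁ x) (proj₁ y)

Semicomplete : Digraph → Set
Semicomplete D = ∀ x y → x ≢ y → Arc D x y ⊎ Arc D y x

CompV : (Tg : Digraph) → (Fin (n Tg) → Digraph) → Set
CompV Tg H = Σ (Fin (n Tg)) λ i → Fin (n (H i))

data CompArc (Tg : Digraph) (H : Fin (n Tg) → Digraph) : CompV Tg H → CompV Tg H → Set where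
  inner : ∀ {i j q} → Arc (H i) j q → CompArc Tg H (i , j) (i , q)
  outer : ∀ {i j p q} → Arc Tg i p → CompArc Tg H (i , j) (p , q)

-- Vertex set of Q - (V(H_i) \ {v}) where v = (i , j).
KeepFor : (Tg : Digraph) (H : Fin (n Tg) → Digraph) → CompV Tg H → CompV Tg H → Set
KeepFor Tg H v w = (proj₁ w ≢ proj₁ v) ⊎ (w ≡ v)

module Submission where

-- (⇒) Two vertices in different blocks are joined by an arc (T is
-- semicomplete), so a k-kernel K (k ≥ 2) lies inside a single block H_i.
-- Pick v ∈ K.  A vertex w outside H_i reaches K, hence H_i, within k-1
-- steps; cutting that walk at its first entry into H_i and redirecting the
-- last arc to v gives a walk to v avoiding V(H_i) \ {v}.
--
-- (⇐) Let v ∈ H_i absorb Q - (V(H_i) \ {v}) within k-1.  Then {v} is a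
-- k-kernel of Q: a singleton is trivially independent, vertices outside H_i
-- are absorbed by hypothesis, and every vertex of H_i reaches v within
-- 3 ≤ k-1 steps.  For the latter, strongness gives an arc of T from i to
-- some block p; a walk from H_p to v avoiding H_i enters v from a block
-- with an arc to i, and semicompleteness yields a shortcut of length ≤ 3.

open import Defs
open import Data.Nat using (ℕ; suc; _≤_; _∸_; z≤n; s≤s)
open import Data.Nat.Properties using (≤-trans; ∸-monoˡ-≤; <⇒≱)
open import Data.Fin using (Fin)
import Data.Fin as Fin
open import Data.Fin.Properties using (_≟_)
open import Data.Product using (Σ; proj₁; proj₂; _,_; _×_)
open import Data.Product.Properties using (≡-dec)
open import Data.Sum using (inj₁; inj₂)
open import Data.Bool using (Bool; true; false; T)
open import Data.Empty using (⊥-elim)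
open import Relation.Nullary using (yes; no)
open import Relation.Nullary.Decidable using (isYes; toWitness; fromWitness)
open import Relation.Binary.Definitions using (DecidableEquality)
open import Function.Bundles using (_⇔_; mk⇔)
open import Relation.Binary.PropositionalEquality using (_≡_; _≢_; refl; sym; trans; cong; subst)

forget-induced : ∀ {V : Set} {R : V → V → Set} {keep : V → Set} {m a b} →
  Walk (InducedArc R keep) m a b → Walk R m (proj₁ a) (proj₁ b)
forget-induced [] = []
forget-induced (e ∷ p) = e ∷ forget-induced p

absorbent-nonempty : ∀ {V : Set} {R : V → V → Set} {ℓ} (K : V → Bool) →
  Absorbent R ℓ (λ x → T (K x)) → V → Σ V λ x → T (K x)
absorbent-nonempty K absorbs x with K x in Kx
... | true  = x , subst T (sym Kx) _
... | false with absorbs x (λ x∈K → subst T Kx x∈K)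
...   | y , y∈K , _ = y , y∈K

singleton : ∀ {V : Set} → DecidableEquality V → V → V → Bool
singleton _≟V_ v w = isYes (w ≟V v)

singleton-kernel : ∀ {V : Set} {R : V → V → Set} {k : ℕ} (_≟V_ : DecidableEquality V) (v : V) →
  (∀ x → x ≢ v → DistLe R (k ∸ 1) x v) → IsKernel R k (singleton _≟V_ v)
singleton-kernel {R = R} {k} _≟V_ v reach = independent , absorbent
  where
  member : ∀ x → T (singleton _≟V_ v x) → x ≡ v
  member x = toWitness

  independent : Independent R k (λ x → T (singleton _≟V_ v x))
  independent x y x∈K y∈K x≢y = ⊥-elim (x≢y (trans (member x x∈K) (sym (member y y∈K))))

  absorbent : Absorbent R (k ∸ 1) (λ x → T (singleton _≟V_ v x))
  absorbent x x∉K = v , fromWitness refl , reach x (λ x≡v → x∉K (fromWitness x≡v))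

arc-head≢tail : (D : Digraph) → ∀ {i p} → Arc D i p → p ≢ i
arc-head≢tail D ip refl = loopless D _ ip

other-index : ∀ {N} → 2 ≤ N → (i : Fin N) → Σ (Fin N) λ j → j ≢ i
other-index (s≤s (s≤s _)) Fin.zero    = Fin.suc Fin.zero , λ ()
other-index (s≤s (s≤s _)) (Fin.suc i) = Fin.zero , λ ()

some-index : ∀ {N} → 1 ≤ N → Fin N
some-index (s≤s _) = Fin.zero

module Composition (Tg : Digraph) (H : Fin (n Tg) → Digraph) where

  V : Set
  V = CompV Tg H

  Q : V → V → Set
  Q = CompArc Tg H

  Q-minus : (v : V) → Σ V (KeepFor Tg H v) → Σ V (KeepFor Tg H v) → Set
  Q-minus v = InducedArc Q (KeepFor Tg H v)

  _≟V_ : DecidableEquality V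
  _≟V_ = ≡-dec _≟_ _≟_

  arc-between-blocks : ∀ {x y} → Q x y → proj₁ x ≢ proj₁ y → Arc Tg (proj₁ x) (proj₁ y)
  arc-between-blocks (inner _) x≁y = ⊥-elim (x≁y refl)
  arc-between-blocks (outer a) _   = a

  independent-one-block : Semicomplete Tg → ∀ {k} {K : V → Set} → 2 ≤ k →
    Independent Q k K → ∀ x y → K x → K y → proj₁ x ≡ proj₁ y
  independent-one-block semi 2≤k ind x y x∈K y∈K with proj₁ x ≟ proj₁ y
  ... | yes same = same
  ... | no differ with ind x y x∈K y∈K (λ x≡y → differ (cong proj₁ x≡y))
                     | semi (proj₁ x) (proj₁ y) differ
  ...   | far , _ | inj₁ a = ⊥-elim (<⇒≱ 2≤k (far 1 (outer a ∷ [])))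
  ...   | _ , far | inj₂ a = ⊥-elim (<⇒≱ 2≤k (far 1 (outer a ∷ [])))

  -- A walk from x outside block i into block i can be cut at its first entry
  -- and redirected to v; the result avoids V(H_i) \ {v} and is no longer.
  redirect-into-block : (v : V) → ∀ {m y} (x : V) (x∉B : proj₁ x ≢ proj₁ v) →
    Walk Q m x y → proj₁ y ≡ proj₁ v →
    Σ ℕ λ m' → m' ≤ m × Walk (Q-minus v) m' (x , inj₁ x∉B) (v , inj₂ refl)
  redirect-into-block v x x∉B [] y∈B = ⊥-elim (x∉B y∈B)
  redirect-into-block v x x∉B (_∷_ {y = x'} e p) y∈B with proj₁ x' ≟ proj₁ v
  ... | yes x'∈B = 1 , s≤s z≤n , (outer into-block ∷ [])
    where
    into-block : Arc Tg (proj₁ x) (proj₁ v)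
    into-block = subst (Arc Tg (proj₁ x)) x'∈B
                   (arc-between-blocks e (λ same → x∉B (trans same x'∈B)))
  ... | no x'∉B with redirect-into-block v x' x'∉B p y∈B
  ...   | m' , m'≤ , W = suc m' , s≤s m'≤ , (e ∷ W)

  exit-arc : ∀ {m y} i a → Walk Q m (i , a) y → proj₁ y ≢ i →
    Σ (Fin (n Tg)) λ p → Fin (n (H p)) × Arc Tg i p
  exit-arc i a [] y∉B = ⊥-elim (y∉B refl)
  exit-arc i a (inner {q = q} _ ∷ p) y∉B = exit-arc i q p y∉B
  exit-arc i a (outer {p = p} {q = q} e ∷ _) _ = p , q , e

  block-out-arc : Strong Q → 2 ≤ n Tg → (∀ i → 1 ≤ n (H i)) → (i : Fin (n Tg)) →
    Fin (n (H i)) → Σ (Fin (n Tg)) λ p → Fin (n (H p)) × Arc Tg i p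
  block-out-arc strong 2≤t nonempty i a with other-index 2≤t i
  ... | j , j≢i with strong (i , a) (j , some-index (nonempty j))
  ...   | _ , W = exit-arc i a W j≢i

  -- Shortcut: let i be v's block and w a vertex outside it with an arc i → block(w)
  -- in T.  Any walk from w to v avoiding V(H_i) \ {v} yields a walk of length
  -- ≤ 3 from every vertex of H_i to v: follow the walk while T has arcs from i,
  -- and stop at the first vertex whose block sends an arc back to i.
  shortcut : Semicomplete Tg → (v : V) (a : Fin (n (H (proj₁ v)))) →
    ∀ {m y} (w : Σ V (KeepFor Tg H v)) → proj₁ (proj₁ w) ≢ proj₁ v →
    Arc Tg (proj₁ v) (proj₁ (proj₁ w)) → Walk (Q-minus v) m w y → proj₁ y ≡ v →
    DistLe Q 3 (proj₁ v , a) v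
  shortcut semi v a w w∉B iw W y≡v with arc? Tg (proj₁ (proj₁ w)) (proj₁ v)
  ... | yes wi = 2 , s≤s (s≤s z≤n) , (outer {q = proj₂ (proj₁ w)} iw ∷ (outer wi ∷ []))
  shortcut semi v a w w∉B iw [] y≡v | no _ = ⊥-elim (w∉B (cong proj₁ y≡v))
  shortcut semi v a w w∉B iw (_∷_ {y = x , inj₂ x≡v} e _) _ | no _ =
    2 , s≤s (s≤s z≤n) , (outer {q = proj₂ (proj₁ w)} iw ∷ (subst (Q (proj₁ w)) x≡v e ∷ []))
  shortcut semi v a w w∉B iw (_∷_ {y = x , inj₁ x∉B} e W) y≡v | no _
    with semi (proj₁ v) (proj₁ x) (λ same → x∉B (sym same))
  ... | inj₁ ix = shortcut semi v a (x , inj₁ x∉B) x∉B ix W y≡v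
  ... | inj₂ xi = 3 , s≤s (s≤s (s≤s z≤n)) , (outer {q = proj₂ (proj₁ w)} iw ∷ (e ∷ (outer xi ∷ [])))

  kernel⇒absorbing-vertex : Semicomplete Tg → (i₀ : Fin (n Tg)) → Fin (n (H i₀)) →
    ∀ {k} → 2 ≤ k → HasKernel Q k →
    Σ V λ v → Absorbent (Q-minus v) (k ∸ 1) (λ w → proj₁ w ≡ v)
  kernel⇒absorbing-vertex semi i₀ a₀ {k} 2≤k (K , ind , absorbs) = v , absorb
    where
    v∈K : Σ V λ v → T (K v)
    v∈K = absorbent-nonempty K absorbs (i₀ , a₀)
    v = proj₁ v∈K

    same-block-as-v : ∀ x → T (K x) → proj₁ x ≡ proj₁ v
    same-block-as-v x x∈K = independent-one-block semi 2≤k ind x v x∈K (proj₂ v∈K)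

    absorb : Absorbent (Q-minus v) (k ∸ 1) (λ w → proj₁ w ≡ v)
    absorb (w , inj₂ w≡v) w≢v = ⊥-elim (w≢v w≡v)
    absorb (w , inj₁ w∉B) _
      with absorbs w (λ w∈K → w∉B (same-block-as-v w w∈K))
    ... | y , y∈K , m , m≤ , W with redirect-into-block v w w∉B W (same-block-as-v y y∈K)
    ...   | m' , m'≤m , W' = (v , inj₂ refl) , refl , m' , ≤-trans m'≤m m≤ , W'

  absorbing-vertex⇒kernel : Semicomplete Tg → Strong Q → 2 ≤ n Tg → (∀ i → 1 ≤ n (H i)) →
    ∀ {k} → 3 ≤ k ∸ 1 → (v : V) → Absorbent (Q-minus v) (k ∸ 1) (λ w → proj₁ w ≡ v) →
    IsKernel Q k (singleton _≟V_ v)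
  absorbing-vertex⇒kernel semi strong 2≤t nonempty {k} 3≤ v absorbs =
    singleton-kernel _≟V_ v reach
    where
    from-block : ∀ a → DistLe Q 3 (proj₁ v , a) v
    from-block a with block-out-arc strong 2≤t nonempty (proj₁ v) a
    ... | p , b , ip = via (arc-head≢tail Tg ip)
      where
      via : p ≢ proj₁ v → DistLe Q 3 (proj₁ v , a) v
      via p≢i with absorbs ((p , b) , inj₁ p≢i) (λ w≡v → p≢i (cong proj₁ w≡v))
      ... | _ , y≡v , _ , _ , W = shortcut semi v a ((p , b) , inj₁ p≢i) p≢i ip W y≡v

    reach : ∀ x → x ≢ v → DistLe Q (k ∸ 1) x v
    reach (i , a) x≢v with i ≟ proj₁ v
    ... | yes refl with from-block a
    ...   | m , m≤3 , W = m , ≤-trans m≤3 3≤ , W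
    reach x x≢v | no x∉B with absorbs (x , inj₁ x∉B) x≢v
    ...   | _ , y≡v , m , m≤ , W = m , m≤ , subst (Walk Q m x) y≡v (forget-induced W)

lemma3p5 : (Tg : Digraph) (H : Fin (n Tg) → Digraph) (k : ℕ) →
    2 ≤ n Tg → (∀ i → 1 ≤ n (H i)) → Semicomplete Tg → Strong (CompArc Tg H) → 4 ≤ k →
    HasKernel (CompArc Tg H) k
      ⇔ Σ (CompV Tg H) λ v →
          Absorbent (InducedArc (CompArc Tg H) (KeepFor Tg H v)) (k ∸ 1)
            (λ w → proj₁ w ≡ v)
lemma3p5 Tg H k 2≤t nonempty semi strong 4≤k = mk⇔ forward backward
  where
  open Composition Tg H

  i₀ : Fin (n Tg)
  i₀ = some-index (≤-trans (s≤s z≤n) 2≤t)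

  forward : HasKernel Q k → Σ V λ v → Absorbent (Q-minus v) (k ∸ 1) (λ w → proj₁ w ≡ v)
  forward = kernel⇒absorbing-vertex semi i₀ (some-index (nonempty i₀)) (≤-trans (s≤s (s≤s z≤n)) 4≤k)

  backward : (Σ V λ v → Absorbent (Q-minus v) (k ∸ 1) (λ w → proj₁ w ≡ v)) → HasKernel Q k
  backward (v , absorbs) =
    singleton _≟V_ v ,
    absorbing-vertex⇒kernel semi strong 2≤t nonempty (∸-monoˡ-≤ 1 4≤k) v absorbs
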